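{- Let $G$ be a connected graph with at least $3$ vertices such that $T_2(G)$ is well-covered. If $x_1,x_2,x_3$ are vertices of $G$ forming an induced path $x_1x_2x_3$ in $G$, then either these three vertices lie on a common $4$-cycle of $G$, or at least one of $x_1,x_2,x_3$ lies on a $3$-cycle of $G$.
   Context: The $2$-token graph $T_2(G)$ has as vertices the $2$-subsets of $V(G)$, two of them adjacent if their symmetric difference is an edge of $G$. A graph is well-covered if all of its maximal (with respect to inclusion) independent sets have the same cardinality. -}

module Defs where

open import Data.Nat using (ℕ; zero; suc; _<ᵇ_)
open import Data.Fin using (Fin; toℕ)
open import Data.Bool using (Bool; true; false; T; _∧_; if_then_else_)
open import Data.List using (List; map; concatMap; allFin)
open import Data.Nat.ListAction using (sum)
open import Data.Product using (Σ; ∃; _×_; _,_)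
open import Data.Sum using (_⊎_)
open import Relation.Nullary using (¬_)
open import Relation.Binary.PropositionalEquality using (_≡_; _≢_)
open import Relation.Binary.Construct.Closure.ReflexiveTransitive using (Star)

record Graph (n : ℕ) : Set where
  field
    adj    : Fin n → Fin n → Bool
    sym    : ∀ u v → adj u v ≡ adj v u
    irrefl : ∀ u → adj u u ≡ false

open Graph public

_∼[_]_ : ∀ {n} → Fin n → Graph n → Fin n → Set
u ∼[ G ] v = T (adj G u v)

Connected : ∀ {n} → Graph n → Set
Connected {n} G = ∀ (u v : Fin n) → Star (λ a b → a ∼[ G ] b) u v

-- The 2-token graph T₂(G).
-- A vertex of T₂(G) (a 2-subset {i , j} of V(G)) is represented by the
-- ordered pair (i , j) with toℕ i < toℕ j.

Token : ℕ → Set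
Token n = Σ (Fin n × Fin n) (λ { (i , j) → T (toℕ i <ᵇ toℕ j) })

-- {i , j} and {k , l} are adjacent in T₂(G) iff their symmetric
-- difference is an edge of G, i.e. they share exactly one vertex and the
-- two remaining vertices are adjacent in G (irreflexivity of G ensures
-- the remaining vertices are distinct).
TokAdj : ∀ {n} → Graph n → Token n → Token n → Set
TokAdj G ((i , j) , _) ((k , l) , _) =
    (i ≡ k × j ∼[ G ] l)
  ⊎ (i ≡ l × j ∼[ G ] k)
  ⊎ (j ≡ k × i ∼[ G ] l)
  ⊎ (j ≡ l × i ∼[ G ] k)

-- A set of vertices of T₂(G): characteristic function, only the entries
-- (i , j) with i < j are meaningful.
TokSet : ℕ → Set
TokSet n = Fin n → Fin n → Bool

_∈T_ : ∀ {n} → Token n → TokSet n → Set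
((i , j) , _) ∈T S = T (S i j)

card : ∀ {n} → TokSet n → ℕ
card {n} S =
  sum (concatMap (λ i → map (λ j → if (toℕ i <ᵇ toℕ j) ∧ S i j then 1 else 0)
                            (allFin n))
                 (allFin n))

Independent : ∀ {n} → Graph n → TokSet n → Set
Independent G S = ∀ t u → t ∈T S → u ∈T S → ¬ TokAdj G t u

MaximalIndependent : ∀ {n} → Graph n → TokSet n → Set
MaximalIndependent G S =
  Independent G S × (∀ t → ¬ (t ∈T S) → ∃ λ u → u ∈T S × TokAdj G t u)

TokenWellCovered : ∀ {n} → Graph n → Set
TokenWellCovered G =
  ∀ S S' → MaximalIndependent G S → MaximalIndependent G S' → card S ≡ card S'

InducedP3 : ∀ {n} → Graph n → Fin n → Fin n → Fin n → Set
InducedP3 G x₁ x₂ x₃ =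
  x₁ ≢ x₃ × x₁ ∼[ G ] x₂ × x₂ ∼[ G ] x₃ × ¬ (x₁ ∼[ G ] x₃)

Cycle4 : ∀ {n} → Graph n → Fin n → Fin n → Fin n → Fin n → Set
Cycle4 G a b c d =
  a ≢ b × a ≢ c × a ≢ d × b ≢ c × b ≢ d × c ≢ d ×
  a ∼[ G ] b × b ∼[ G ] c × c ∼[ G ] d × d ∼[ G ] a

_∈4_ : ∀ {n} → Fin n → Fin n × Fin n × Fin n × Fin n → Set
x ∈4 (a , b , c , d) = x ≡ a ⊎ x ≡ b ⊎ x ≡ c ⊎ x ≡ d

OnCommon4Cycle : ∀ {n} → Graph n → Fin n → Fin n → Fin n → Set
OnCommon4Cycle G x₁ x₂ x₃ =
  ∃ λ a → ∃ λ b → ∃ λ c → ∃ λ d →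
    Cycle4 G a b c d ×
    x₁ ∈4 (a , b , c , d) × x₂ ∈4 (a , b , c , d) × x₃ ∈4 (a , b , c , d)

OnTriangle : ∀ {n} → Graph n → Fin n → Set
OnTriangle G x =
  ∃ λ b → ∃ λ c → x ≢ b × x ≢ c × b ≢ c ×
    x ∼[ G ] b × b ∼[ G ] c × c ∼[ G ] x

-- Suppose the path x₁x₂x₃ lies on no 4-cycle and no xᵢ lies on a triangle, and let X = {x₁, x₂, x₃}.
-- The token x₁x₃ together with the tokens uy of all edges of G with u ∈ X and y ∉ X is independent
-- in T₂(G): an adjacency would give a common neighbour y ≠ x₂ of x₁ and x₃, or a triangle at a
-- vertex of X. Extend it to a maximal independent set M. Replacing x₁x₃ in M by x₁x₂ and x₂x₃ keeps
-- it independent: a token of M adjacent to one of them has the form uw with u ∈ X and w ∉ X, where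
-- w ∼ v for some v ∈ X with u ∼ v, so it is adjacent to the cross-edge token vw ∈ M. The resulting
-- independent set is one larger than M, hence so is each of its maximal extensions.

module Submission where

open import Defs hiding (sym)
open import Data.Bool using (Bool; true; false; T; not; _∧_; _∨_; if_then_else_)
open import Data.Bool.Properties using (T-irrelevant; ∧-comm; ∧-assoc)
open import Data.Empty using (⊥; ⊥-elim)
open import Data.Fin using (Fin; zero; suc; toℕ)
open import Data.Fin.Properties using (_≟_; any?; toℕ-injective)
open import Data.List using (List; []; _∷_; map; concat; foldl; tabulate; allFin; cartesianProduct)
open import Data.List.Properties using (map-∘)
open import Data.List.Membership.Propositional using (_∈_)
open import Data.List.Membership.Propositional.Properties using (∈-cartesianProduct⁺; ∈-allFin)
open import Data.List.Relation.Unary.Any using (here; there)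
open import Data.Nat using (ℕ; zero; suc; _+_; _≤_; _<ᵇ_; z≤n; s≤s)
open import Data.Nat.ListAction using (sum)
open import Data.Nat.ListAction.Properties using (sum-++)
open import Data.Nat.Properties using (+-0-commutativeMonoid; +-mono-≤; +-identityʳ; <ᵇ⇒<; <⇒<ᵇ; <-cmp; <-irrefl; +-cancelˡ-≤)
open import Data.Product using (Σ; ∃; ∃₂; _×_; _,_; proj₁; proj₂)
open import Data.Sum using (_⊎_; inj₁; inj₂; swap; map₂)
open import Function using (_∘_; id)
open import Relation.Binary.Definitions using (tri<; tri≈; tri>)
open import Relation.Binary.PropositionalEquality using (_≡_; _≢_; refl; sym; trans; cong; cong₂; subst; subst₂; module ≡-Reasoning)
open import Relation.Nullary using (¬_; Dec; yes; no; does)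
open import Relation.Nullary.Decidable using (_×-dec_; _⊎-dec_; ¬?; T?; map′)

open import Algebra.Properties.CommutativeMonoid.Sum +-0-commutativeMonoid
  using (sum-syntax; ∑-distrib-+; sum-cong-≗; sum-replicate-zero) renaming (sum to ∑)
open ≡-Reasoning

T-does⁻ : ∀ {P : Set} (P? : Dec P) → T (does P?) → P
T-does⁻ (yes p) _ = p

T-does⁺ : ∀ {P : Set} (P? : Dec P) → P → T (does P?)
T-does⁺ (yes _) _ = _
T-does⁺ (no ¬p) p = ¬p p

count : Bool → ℕ
count b = if b then 1 else 0

count-T : ∀ {b} → T b → count b ≡ 1
count-T {true} _ = refl

count-¬T : ∀ {b} → ¬ T b → count b ≡ 0
count-¬T {true}  ¬b = ⊥-elim (¬b _)
count-¬T {false} _  = refl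

count-∨ : ∀ l a b → (T l → T a → T b → ⊥) → count (l ∧ (a ∨ b)) ≡ count (l ∧ a) + count (l ∧ b)
count-∨ false a     b     _ = refl
count-∨ true  true  true  d = ⊥-elim (d _ _ _)
count-∨ true  true  false _ = refl
count-∨ true  false b     _ = refl

count-∖ : ∀ l a b → (T l → T b → T a) → count (l ∧ a) ≡ count (l ∧ (a ∧ not b)) + count (l ∧ b)
count-∖ false a     b     _ = refl
count-∖ true  true  true  _ = refl
count-∖ true  true  false _ = refl
count-∖ true  false true  h = ⊥-elim (h _ _)
count-∖ true  false false _ = refl

count-mono : ∀ l a b → (T l → T a → T b) → count (l ∧ a) ≤ count (l ∧ b)
count-mono false a     b     _ = z≤n
count-mono true  false b     _ = z≤n
count-mono true  true  true  _ = s≤s z≤n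
count-mono true  true  false h = ⊥-elim (h _ _)

∑-mono-≤ : ∀ {m} {f g : Fin m → ℕ} → (∀ i → f i ≤ g i) → ∑ f ≤ ∑ g
∑-mono-≤ {zero}  _   = z≤n
∑-mono-≤ {suc m} f≤g = +-mono-≤ (f≤g zero) (∑-mono-≤ (f≤g ∘ suc))

∑-indicator : ∀ {m} (q : Fin m) (b : Fin m → Bool) → ∑[ j < m ] count (does (j ≟ q) ∧ b j) ≡ count (b q)
∑-indicator {suc m} zero    b = trans (cong (count (b zero) +_) (sum-replicate-zero m)) (+-identityʳ _)
∑-indicator {suc m} (suc q) b = ∑-indicator {m} q (λ j → b (suc j))

sum-concat : (xss : List (List ℕ)) → sum (concat xss) ≡ sum (map sum xss)
sum-concat []         = refl
sum-concat (xs ∷ xss) = trans (sum-++ xs (concat xss)) (cong (sum xs +_) (sum-concat xss))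

sum-map-tabulate : ∀ {A : Set} {m} (g : Fin m → A) (f : A → ℕ) → sum (map f (tabulate g)) ≡ ∑[ i < m ] f (g i)
sum-map-tabulate {m = zero}  g f = refl
sum-map-tabulate {m = suc m} g f = cong (f (g zero) +_) (sum-map-tabulate (g ∘ suc) f)

_≺_ : ∀ {n} → Fin n → Fin n → Bool
i ≺ j = toℕ i <ᵇ toℕ j

weight : ∀ {n} → TokSet n → Fin n → Fin n → ℕ
weight S i j = count (i ≺ j ∧ S i j)

card≡∑∑ : ∀ {n} (S : TokSet n) → card S ≡ ∑[ i < n ] ∑[ j < n ] weight S i j
card≡∑∑ {n} S = begin
  sum (concat (map row (allFin n)))  ≡⟨ sum-concat (map row (allFin n)) ⟩
  sum (map sum (map row (allFin n))) ≡⟨ cong sum (map-∘ (allFin n)) ⟨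
  sum (map (sum ∘ row) (allFin n))   ≡⟨ sum-map-tabulate id (sum ∘ row) ⟩
  ∑[ i < n ] sum (row i)             ≡⟨ sum-cong-≗ (λ i → sum-map-tabulate id (weight S i)) ⟩
  ∑[ i < n ] ∑[ j < n ] weight S i j ∎
  where
  row : Fin n → List ℕ
  row i = map (weight S i) (allFin n)

card-split : ∀ {n} {S S₁ S₂ : TokSet n} → (∀ i j → weight S i j ≡ weight S₁ i j + weight S₂ i j) →
  card S ≡ card S₁ + card S₂
card-split {n} {S} {S₁} {S₂} split = begin
  card S                                                          ≡⟨ card≡∑∑ S ⟩
  ∑[ i < n ] ∑[ j < n ] weight S i j                              ≡⟨ sum-cong-≗ row-split ⟩
  ∑[ i < n ] (∑[ j < n ] weight S₁ i j + ∑[ j < n ] weight S₂ i j)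
      ≡⟨ ∑-distrib-+ (λ i → ∑[ j < n ] weight S₁ i j) (λ i → ∑[ j < n ] weight S₂ i j) ⟩
  ∑[ i < n ] ∑[ j < n ] weight S₁ i j + ∑[ i < n ] ∑[ j < n ] weight S₂ i j
                                                                  ≡⟨ cong₂ _+_ (card≡∑∑ S₁) (card≡∑∑ S₂) ⟨
  card S₁ + card S₂                                               ∎
  where
  row-split : ∀ i → ∑[ j < n ] weight S i j ≡ ∑[ j < n ] weight S₁ i j + ∑[ j < n ] weight S₂ i j
  row-split i = trans (sum-cong-≗ (split i)) (∑-distrib-+ (weight S₁ i) (weight S₂ i))

card-mono-≤ : ∀ {n} {S S' : TokSet n} → (∀ i j → weight S i j ≤ weight S' i j) → card S ≤ card S'
card-mono-≤ {S = S} {S'} ≤w =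
  subst₂ _≤_ (sym (card≡∑∑ S)) (sym (card≡∑∑ S')) (∑-mono-≤ (λ i → ∑-mono-≤ (≤w i)))

≺-irrefl : ∀ {n} (u : Fin n) → ¬ T (u ≺ u)
≺-irrefl u u≺u = <-irrefl refl (<ᵇ⇒< (toℕ u) (toℕ u) u≺u)

≺-flip : ∀ {n} {u v : Fin n} → u ≢ v → (T (u ≺ v) × ¬ T (v ≺ u)) ⊎ (¬ T (u ≺ v) × T (v ≺ u))
≺-flip {u = u} {v} u≢v with <-cmp (toℕ u) (toℕ v)
... | tri< u<v _ v≮u = inj₁ (<⇒<ᵇ u<v , v≮u ∘ <ᵇ⇒< (toℕ v) (toℕ u))
... | tri≈ _ u≡v _   = ⊥-elim (u≢v (toℕ-injective u≡v))
... | tri> u≮v _ v<u = inj₂ (u≮v ∘ <ᵇ⇒< (toℕ u) (toℕ v) , <⇒<ᵇ v<u)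

count-≺-flip : ∀ {n} {u v : Fin n} → u ≢ v → count (u ≺ v) + count (v ≺ u) ≡ 1
count-≺-flip u≢v with ≺-flip u≢v
... | inj₁ (u≺v , v⊀u) = cong₂ _+_ (count-T u≺v) (count-¬T v⊀u)
... | inj₂ (u⊀v , v≺u) = cong₂ _+_ (count-¬T u⊀v) (count-T v≺u)

module _ {n : ℕ} where

  infixr 25 _∪_ _∖_
  infix 4 _⊆_

  -- Only the entries (i , j) with i ≺ j are tokens; inclusion and disjointness ignore the rest.
  _⊆_ : TokSet n → TokSet n → Set
  S ⊆ S' = ∀ t → t ∈T S → t ∈T S'

  Disjoint : TokSet n → TokSet n → Set
  Disjoint S S' = ∀ t → t ∈T S → t ∈T S' → ⊥

  _∪_ _∖_ : TokSet n → TokSet n → TokSet n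
  (S ∪ S') i j = S i j ∨ S' i j
  (S ∖ S') i j = S i j ∧ not (S' i j)

  ∈-∪⁻ : ∀ {S S'} t → t ∈T S ∪ S' → t ∈T S ⊎ t ∈T S'
  ∈-∪⁻ {S} {S'} ((i , j) , _) = T-does⁻ (T? (S i j) ⊎-dec T? (S' i j))

  ∈-∪⁺ˡ : ∀ {S S'} t → t ∈T S → t ∈T S ∪ S'
  ∈-∪⁺ˡ {S} {S'} ((i , j) , _) = T-does⁺ (T? (S i j) ⊎-dec T? (S' i j)) ∘ inj₁

  ∈-∪⁺ʳ : ∀ {S S'} t → t ∈T S' → t ∈T S ∪ S'
  ∈-∪⁺ʳ {S} {S'} ((i , j) , _) = T-does⁺ (T? (S i j) ⊎-dec T? (S' i j)) ∘ inj₂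

  ∈-∖⁻ : ∀ {S B} t → t ∈T S ∖ B → t ∈T S × ¬ t ∈T B
  ∈-∖⁻ {S} {B} ((i , j) , _) = T-does⁻ (T? (S i j) ×-dec ¬? (T? (B i j)))

  card-∪ : {S S' : TokSet n} → Disjoint S S' → card (S ∪ S') ≡ card S + card S'
  card-∪ {S} {S'} disj = card-split (λ i j → count-∨ (i ≺ j) (S i j) (S' i j) (λ p → disj ((i , j) , p)))

  card-∖ : {S B : TokSet n} → B ⊆ S → card S ≡ card (S ∖ B) + card B
  card-∖ {S} {B} B⊆S = card-split (λ i j → count-∖ (i ≺ j) (S i j) (B i j) (λ p → B⊆S ((i , j) , p)))

  card-mono : {S S' : TokSet n} → S ⊆ S' → card S ≤ card S'
  card-mono {S} {S'} S⊆S' = card-mono-≤ (λ i j → count-mono (i ≺ j) (S i j) (S' i j) (λ p → S⊆S' ((i , j) , p)))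

  ⟪_,_⟫ : Fin n → Fin n → TokSet n
  ⟪ u , v ⟫ i j = does (i ≟ u) ∧ does (j ≟ v)

  ∈-⟪⟫⁻ : ∀ {u v} (t : Token n) → t ∈T ⟪ u , v ⟫ → proj₁ (proj₁ t) ≡ u × proj₂ (proj₁ t) ≡ v
  ∈-⟪⟫⁻ {u} {v} ((i , j) , _) = T-does⁻ ((i ≟ u) ×-dec (j ≟ v))

  card-⟪⟫ : (u v : Fin n) → card ⟪ u , v ⟫ ≡ count (u ≺ v)
  card-⟪⟫ u v = begin
    card ⟪ u , v ⟫                                                     ≡⟨ card≡∑∑ ⟪ u , v ⟫ ⟩
    ∑[ i < n ] ∑[ j < n ] count (i ≺ j ∧ (does (i ≟ u) ∧ does (j ≟ v)))
        ≡⟨ sum-cong-≗ (λ i → sum-cong-≗ (λ j → cong count (shuffle (i ≺ j) (does (i ≟ u)) (does (j ≟ v))))) ⟩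
    ∑[ i < n ] ∑[ j < n ] count (does (j ≟ v) ∧ (does (i ≟ u) ∧ i ≺ j))
        ≡⟨ sum-cong-≗ (λ i → ∑-indicator v (λ j → does (i ≟ u) ∧ i ≺ j)) ⟩
    ∑[ i < n ] count (does (i ≟ u) ∧ i ≺ v)                            ≡⟨ ∑-indicator u (_≺ v) ⟩
    count (u ≺ v)                                                      ∎
    where
    shuffle : ∀ a b c → a ∧ (b ∧ c) ≡ c ∧ (b ∧ a)
    shuffle a b c = trans (∧-comm a (b ∧ c)) (trans (cong (_∧ a) (∧-comm b c)) (∧-assoc c b a))

  SamePair : Fin n → Fin n → Fin n → Fin n → Set
  SamePair i j u v = (i ≡ u × j ≡ v) ⊎ (i ≡ v × j ≡ u)

  SamePair? : ∀ i j u v → Dec (SamePair i j u v)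
  SamePair? i j u v = ((i ≟ u) ×-dec (j ≟ v)) ⊎-dec ((i ≟ v) ×-dec (j ≟ u))

  IsPair : Token n → Fin n → Fin n → Set
  IsPair ((i , j) , _) = SamePair i j

  pair : Fin n → Fin n → TokSet n
  pair u v i j = does (SamePair? i j u v)

  ∈-pair⁻ : ∀ {u v} t → t ∈T pair u v → IsPair t u v
  ∈-pair⁻ {u} {v} ((i , j) , _) = T-does⁻ (SamePair? i j u v)

  ∈-pair⁺ : ∀ {u v} t → IsPair t u v → t ∈T pair u v
  ∈-pair⁺ {u} {v} ((i , j) , _) = T-does⁺ (SamePair? i j u v)

  IsPair-swap : ∀ {t : Token n} {u v : Fin n} → IsPair t u v → IsPair t v u
  IsPair-swap {(_ , _) , _} = swap

  IsPair-unique : ∀ {t : Token n} {u v u' v' : Fin n} → IsPair t u v → IsPair t u' v' → SamePair u v u' v'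
  IsPair-unique {(_ , _) , _} (inj₁ (refl , refl)) (inj₁ (refl , refl)) = inj₁ (refl , refl)
  IsPair-unique {(_ , _) , _} (inj₁ (refl , refl)) (inj₂ (refl , refl)) = inj₂ (refl , refl)
  IsPair-unique {(_ , _) , _} (inj₂ (refl , refl)) (inj₁ (refl , refl)) = inj₂ (refl , refl)
  IsPair-unique {(_ , _) , _} (inj₂ (refl , refl)) (inj₂ (refl , refl)) = inj₁ (refl , refl)

  IsPair-degenerate : ∀ {t : Token n} {u : Fin n} → ¬ IsPair t u u
  IsPair-degenerate {(i , _) , i≺i} (inj₁ (refl , refl)) = ≺-irrefl i i≺i
  IsPair-degenerate {(i , _) , i≺i} (inj₂ (refl , refl)) = ≺-irrefl i i≺i

  token : ∀ {u v : Fin n} → u ≢ v → ∃ λ t → IsPair t u v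
  token u≢v with ≺-flip u≢v
  ... | inj₁ (u≺v , _) = (_ , u≺v) , inj₁ (refl , refl)
  ... | inj₂ (_ , v≺u) = (_ , v≺u) , inj₂ (refl , refl)

  _∈T?_ : (t : Token n) (S : TokSet n) → Dec (t ∈T S)
  ((i , j) , _) ∈T? S = T? (S i j)

  token-at? : {P : Token n → Set} → (∀ t → Dec (P t)) → ∀ i j → Dec (Σ (T (i ≺ j)) λ i≺j → P ((i , j) , i≺j))
  token-at? {P} P? i j with T? (i ≺ j)
  ... | yes i≺j = map′ (i≺j ,_) (λ (i≺j′ , p) → subst (λ q → P ((i , j) , q)) (T-irrelevant i≺j′ i≺j) p) (P? ((i , j) , i≺j))
  ... | no  i⊀j = no (i⊀j ∘ proj₁)

  any-token? : {P : Token n → Set} → (∀ t → Dec (P t)) → Dec (∃ P)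
  any-token? P? =
    map′ (λ (i , j , i≺j , p) → ((i , j) , i≺j) , p) (λ (((i , j) , i≺j) , p) → i , j , i≺j , p)
         (any? λ i → any? λ j → token-at? P? i j)

  -- pair u v unfolds definitionally to ⟪ u , v ⟫ ∪ ⟪ v , u ⟫.
  card-pair : {u v : Fin n} → u ≢ v → card (pair u v) ≡ 1
  card-pair {u} {v} u≢v = begin
    card (⟪ u , v ⟫ ∪ ⟪ v , u ⟫)        ≡⟨ card-∪ disjoint ⟩
    card ⟪ u , v ⟫ + card ⟪ v , u ⟫     ≡⟨ cong₂ _+_ (card-⟪⟫ u v) (card-⟪⟫ v u) ⟩
    count (u ≺ v) + count (v ≺ u)       ≡⟨ count-≺-flip u≢v ⟩
    1                                   ∎
    where
    disjoint : Disjoint ⟪ u , v ⟫ ⟪ v , u ⟫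
    disjoint t t∈uv t∈vu = u≢v (trans (sym (proj₁ (∈-⟪⟫⁻ t t∈uv))) (proj₁ (∈-⟪⟫⁻ t t∈vu)))

module TokenGraph {n : ℕ} (G : Graph n) where

  infix 4 _∼_
  _∼_ : Fin n → Fin n → Set
  u ∼ v = u ∼[ G ] v

  ∼-sym : ∀ {u v} → u ∼ v → v ∼ u
  ∼-sym {u} {v} = subst T (Graph.sym G u v)

  ∼-irrefl : ∀ {u} → ¬ u ∼ u
  ∼-irrefl {u} = subst T (irrefl G u)

  ∼⇒≢ : ∀ {u v} → u ∼ v → u ≢ v
  ∼⇒≢ u∼u refl = ∼-irrefl u∼u

  triangle : ∀ {u b c} → u ∼ b → b ∼ c → c ∼ u → OnTriangle G u
  triangle u∼b b∼c c∼u = _ , _ , ∼⇒≢ u∼b , ∼⇒≢ (∼-sym c∼u) , ∼⇒≢ b∼c , u∼b , b∼c , c∼u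

  common-neighbour : ∀ {x₁ x₂ x₃ y} → InducedP3 G x₁ x₂ x₃ → y ≢ x₂ → x₁ ∼ y → y ∼ x₃ →
    OnCommon4Cycle G x₁ x₂ x₃
  common-neighbour (x₁≢x₃ , x₁∼x₂ , x₂∼x₃ , _) y≢x₂ x₁∼y y∼x₃ =
    _ , _ , _ , _ ,
    (∼⇒≢ x₁∼x₂ , x₁≢x₃ , ∼⇒≢ x₁∼y , ∼⇒≢ x₂∼x₃ , y≢x₂ ∘ sym , ∼⇒≢ (∼-sym y∼x₃) ,
     x₁∼x₂ , x₂∼x₃ , ∼-sym y∼x₃ , ∼-sym x₁∼y) ,
    inj₁ refl , inj₂ (inj₁ refl) , inj₂ (inj₂ (inj₁ refl))

  TokAdj-sym : ∀ t t' → TokAdj G t t' → TokAdj G t' t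
  TokAdj-sym ((_ , _) , _) ((_ , _) , _) (inj₁ (refl , a))                 = inj₁ (refl , ∼-sym a)
  TokAdj-sym ((_ , _) , _) ((_ , _) , _) (inj₂ (inj₁ (refl , a)))          = inj₂ (inj₂ (inj₁ (refl , ∼-sym a)))
  TokAdj-sym ((_ , _) , _) ((_ , _) , _) (inj₂ (inj₂ (inj₁ (refl , a))))   = inj₂ (inj₁ (refl , ∼-sym a))
  TokAdj-sym ((_ , _) , _) ((_ , _) , _) (inj₂ (inj₂ (inj₂ (refl , a))))   = inj₂ (inj₂ (inj₂ (refl , ∼-sym a)))

  TokAdj-intro : ∀ {t t' : Token n} {w a b : Fin n} → IsPair t w a → IsPair t' w b → a ∼ b → TokAdj G t t'
  TokAdj-intro {(_ , _) , _} {(_ , _) , _} (inj₁ (refl , refl)) (inj₁ (refl , refl)) a∼b = inj₁ (refl , a∼b)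
  TokAdj-intro {(_ , _) , _} {(_ , _) , _} (inj₁ (refl , refl)) (inj₂ (refl , refl)) a∼b = inj₂ (inj₁ (refl , a∼b))
  TokAdj-intro {(_ , _) , _} {(_ , _) , _} (inj₂ (refl , refl)) (inj₁ (refl , refl)) a∼b = inj₂ (inj₂ (inj₁ (refl , a∼b)))
  TokAdj-intro {(_ , _) , _} {(_ , _) , _} (inj₂ (refl , refl)) (inj₂ (refl , refl)) a∼b = inj₂ (inj₂ (inj₂ (refl , a∼b)))

  TokAdj-elimᵒ : ∀ {t : Token n} {k l : Fin n} {q : T (k ≺ l)} → TokAdj G t ((k , l) , q) →
    (∃ λ w → IsPair t k w × l ∼ w) ⊎ (∃ λ w → IsPair t l w × k ∼ w)
  TokAdj-elimᵒ {(_ , _) , _} (inj₁ (refl , a))               = inj₁ (_ , inj₁ (refl , refl) , ∼-sym a)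
  TokAdj-elimᵒ {(_ , _) , _} (inj₂ (inj₁ (refl , a)))        = inj₂ (_ , inj₁ (refl , refl) , ∼-sym a)
  TokAdj-elimᵒ {(_ , _) , _} (inj₂ (inj₂ (inj₁ (refl , a)))) = inj₁ (_ , inj₂ (refl , refl) , ∼-sym a)
  TokAdj-elimᵒ {(_ , _) , _} (inj₂ (inj₂ (inj₂ (refl , a)))) = inj₂ (_ , inj₂ (refl , refl) , ∼-sym a)

  TokAdj-elim : ∀ {t t' : Token n} {u v : Fin n} → IsPair t' u v → TokAdj G t t' →
    (∃ λ w → IsPair t u w × v ∼ w) ⊎ (∃ λ w → IsPair t v w × u ∼ w)
  TokAdj-elim {t} {(_ , _) , q} (inj₁ (refl , refl)) adj = TokAdj-elimᵒ {t} {q = q} adj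
  TokAdj-elim {t} {(_ , _) , q} (inj₂ (refl , refl)) adj = swap (TokAdj-elimᵒ {t} {q = q} adj)

  TokAdj-same-pair : ∀ {t t' : Token n} {u v : Fin n} → IsPair t u v → IsPair t' u v → ¬ TokAdj G t t'
  TokAdj-same-pair {t} {t'} t≋uv t'≋uv adj with TokAdj-elim {t} {t'} t'≋uv adj
  ... | inj₁ (w , t≋uw , v∼w) with IsPair-unique {t = t} t≋uv t≋uw
  ...   | inj₁ (_ , refl)    = ∼-irrefl v∼w
  ...   | inj₂ (refl , refl) = ∼-irrefl v∼w
  TokAdj-same-pair {t} {t'} t≋uv t'≋uv adj | inj₂ (w , t≋vw , u∼w) with IsPair-unique {t = t} t≋uv t≋vw
  ...   | inj₁ (refl , refl) = ∼-irrefl u∼w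
  ...   | inj₂ (refl , _)    = ∼-irrefl u∼w

  TokAdj? : ∀ t t' → Dec (TokAdj G t t')
  TokAdj? ((i , j) , _) ((k , l) , _) =
    ((i ≟ k) ×-dec T? (adj G j l)) ⊎-dec ((i ≟ l) ×-dec T? (adj G j k)) ⊎-dec
    ((j ≟ k) ×-dec T? (adj G i l)) ⊎-dec ((j ≟ l) ×-dec T? (adj G i k))

  ⊆-independent : ∀ {S S' : TokSet n} → S ⊆ S' → Independent G S' → Independent G S
  ⊆-independent S⊆S' ind t t' t∈S t'∈S = ind t t' (S⊆S' t t∈S) (S⊆S' t' t'∈S)

  ∪-independent : ∀ {S S' : TokSet n} → Independent G S → Independent G S' →
    (∀ t t' → t ∈T S → t' ∈T S' → ¬ TokAdj G t t') → Independent G (S ∪ S')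
  ∪-independent {S} {S'} indS indS' cross t t' t∈ t'∈ with ∈-∪⁻ {S = S} {S'} t t∈ | ∈-∪⁻ {S = S} {S'} t' t'∈
  ... | inj₁ t∈S  | inj₁ t'∈S  = indS t t' t∈S t'∈S
  ... | inj₁ t∈S  | inj₂ t'∈S' = cross t t' t∈S t'∈S'
  ... | inj₂ t∈S' | inj₁ t'∈S  = cross t' t t'∈S t∈S' ∘ TokAdj-sym t t'
  ... | inj₂ t∈S' | inj₂ t'∈S' = indS' t t' t∈S' t'∈S'

  pair-independent : ∀ {u v : Fin n} → Independent G (pair u v)
  pair-independent t t' t∈ t'∈ = TokAdj-same-pair {t} {t'} (∈-pair⁻ t t∈) (∈-pair⁻ t' t'∈)

  Dominated : TokSet n → Token n → Set
  Dominated S t = t ∈T S ⊎ ∃ λ u → u ∈T S × TokAdj G t u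

  Dominated? : ∀ (S : TokSet n) t → Dec (Dominated S t)
  Dominated? S t = (t ∈T? S) ⊎-dec any-token? (λ u → (u ∈T? S) ×-dec TokAdj? t u)

  Dominated-mono : ∀ {S S' : TokSet n} → S ⊆ S' → ∀ t → Dominated S t → Dominated S' t
  Dominated-mono S⊆S' t (inj₁ t∈S)               = inj₁ (S⊆S' t t∈S)
  Dominated-mono S⊆S' t (inj₂ (u , u∈S , t∼u))   = inj₂ (u , S⊆S' u u∈S , t∼u)

  Addable : TokSet n → Fin n → Fin n → Set
  Addable S i j = Σ (T (i ≺ j)) λ i≺j → ¬ Dominated S ((i , j) , i≺j)

  Addable? : ∀ (S : TokSet n) i j → Dec (Addable S i j)
  Addable? S i j = token-at? (λ t → ¬? (Dominated? S t)) i j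

  add : TokSet n → Fin n × Fin n → TokSet n
  add S (i , j) = if does (Addable? S i j) then S ∪ ⟪ i , j ⟫ else S

  ⊆-add : ∀ S x → S ⊆ add S x
  ⊆-add S (i , j) t t∈S with Addable? S i j
  ... | yes _ = ∈-∪⁺ˡ {S = S} {⟪ i , j ⟫} t t∈S
  ... | no  _ = t∈S

  add-independent : ∀ {S} x → Independent G S → Independent G (add S x)
  add-independent {S} (i , j) ind with Addable? S i j
  ... | no  _              = ind
  ... | yes (i≺j , ¬dom) = ∪-independent ind ⟪⟫-independent fresh
    where
    ⟪⟫-independent : Independent G ⟪ i , j ⟫
    ⟪⟫-independent t t' t∈ t'∈ with ∈-⟪⟫⁻ t t∈ | ∈-⟪⟫⁻ t' t'∈
    ... | refl , refl | refl , refl = TokAdj-same-pair {t} {t'} (inj₁ (refl , refl)) (inj₁ (refl , refl))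
    fresh : ∀ t t' → t ∈T S → t' ∈T ⟪ i , j ⟫ → ¬ TokAdj G t t'
    fresh t t' t∈S t'∈ adj with ∈-⟪⟫⁻ t' t'∈
    ... | refl , refl = ¬dom (inj₂ (t , t∈S , TokAdj-sym t t' adj))

  add-dominates : ∀ S i j (i≺j : T (i ≺ j)) → Dominated (add S (i , j)) ((i , j) , i≺j)
  add-dominates S i j i≺j with Addable? S i j
  ... | yes _   = inj₁ (∈-∪⁺ʳ {S = S} {⟪ i , j ⟫} ((i , j) , i≺j) (T-does⁺ ((i ≟ i) ×-dec (j ≟ j)) (refl , refl)))
  ... | no ¬add with Dominated? S ((i , j) , i≺j)
  ...   | yes dom = dom
  ...   | no ¬dom = ⊥-elim (¬add (i≺j , ¬dom))

  greedy : TokSet n → List (Fin n × Fin n) → TokSet n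
  greedy = foldl add

  ⊆-greedy : ∀ S xs → S ⊆ greedy S xs
  ⊆-greedy S []       t t∈S = t∈S
  ⊆-greedy S (x ∷ xs) t t∈S = ⊆-greedy (add S x) xs t (⊆-add S x t t∈S)

  greedy-independent : ∀ {S} xs → Independent G S → Independent G (greedy S xs)
  greedy-independent []       ind = ind
  greedy-independent (x ∷ xs) ind = greedy-independent xs (add-independent x ind)

  greedy-dominates : ∀ S xs {i j} (i≺j : T (i ≺ j)) → (i , j) ∈ xs → Dominated (greedy S xs) ((i , j) , i≺j)
  greedy-dominates S (_ ∷ xs) {i} {j} i≺j (here refl) =
    Dominated-mono (⊆-greedy (add S (i , j)) xs) ((i , j) , i≺j) (add-dominates S i j i≺j)
  greedy-dominates S (x ∷ xs) i≺j (there ij∈xs) = greedy-dominates (add S x) xs i≺j ij∈xs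

  extend-to-maximal : ∀ {S} → Independent G S → ∃ λ M → MaximalIndependent G M × S ⊆ M
  extend-to-maximal {S} ind = greedy S pairs , (greedy-independent pairs ind , maximal) , ⊆-greedy S pairs
    where
    pairs : List (Fin n × Fin n)
    pairs = cartesianProduct (allFin n) (allFin n)
    maximal : ∀ t → ¬ t ∈T greedy S pairs → ∃ λ u → u ∈T greedy S pairs × TokAdj G t u
    maximal ((i , j) , i≺j) t∉M with greedy-dominates S pairs i≺j (∈-cartesianProduct⁺ (∈-allFin i) (∈-allFin j))
    ... | inj₁ t∈M = ⊥-elim (t∉M t∈M)
    ... | inj₂ nbr = nbr

module Obstruction {n : ℕ} (G : Graph n) {x₁ x₂ x₃ : Fin n}
  (x₁≢x₃ : x₁ ≢ x₃) (x₁∼x₂ : x₁ ∼[ G ] x₂) (x₂∼x₃ : x₂ ∼[ G ] x₃) (x₁≁x₃ : ¬ x₁ ∼[ G ] x₃)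
  (¬C₄ : ¬ OnCommon4Cycle G x₁ x₂ x₃)
  (¬Δ₁ : ¬ OnTriangle G x₁) (¬Δ₂ : ¬ OnTriangle G x₂) (¬Δ₃ : ¬ OnTriangle G x₃) where

  open TokenGraph G

  IsX : Fin n → Set
  IsX u = u ≡ x₁ ⊎ u ≡ x₂ ⊎ u ≡ x₃

  IsX? : ∀ u → Dec (IsX u)
  IsX? u = (u ≟ x₁) ⊎-dec (u ≟ x₂) ⊎-dec (u ≟ x₃)

  no-triangle : ∀ {u b c} → IsX u → u ∼ b → b ∼ c → c ∼ u → ⊥
  no-triangle (inj₁ refl)        u∼b b∼c c∼u = ¬Δ₁ (triangle u∼b b∼c c∼u)
  no-triangle (inj₂ (inj₁ refl)) u∼b b∼c c∼u = ¬Δ₂ (triangle u∼b b∼c c∼u)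
  no-triangle (inj₂ (inj₂ refl)) u∼b b∼c c∼u = ¬Δ₃ (triangle u∼b b∼c c∼u)

  no-common-neighbour : ∀ {y} → ¬ IsX y → x₁ ∼ y → y ∼ x₃ → ⊥
  no-common-neighbour y∉X x₁∼y y∼x₃ =
    ¬C₄ (common-neighbour (x₁≢x₃ , x₁∼x₂ , x₂∼x₃ , x₁≁x₃) (y∉X ∘ inj₂ ∘ inj₁) x₁∼y y∼x₃)

  CrossEdge : Fin n → Fin n → Set
  CrossEdge i j = ∃₂ λ u y → SamePair i j u y × IsX u × ¬ IsX y × u ∼ y

  CrossEdge? : ∀ i j → Dec (CrossEdge i j)
  CrossEdge? i j = any? λ u → any? λ y → SamePair? i j u y ×-dec IsX? u ×-dec ¬? (IsX? y) ×-dec T? (adj G u y)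

  crossEdges : TokSet n
  crossEdges i j = does (CrossEdge? i j)

  ∈-crossEdges⁻ : ∀ t → t ∈T crossEdges → ∃₂ λ u y → IsPair t u y × IsX u × ¬ IsX y × u ∼ y
  ∈-crossEdges⁻ ((i , j) , _) = T-does⁻ (CrossEdge? i j)

  ∈-crossEdges⁺ : ∀ {t u y} → IsPair t u y → IsX u → ¬ IsX y → u ∼ y → t ∈T crossEdges
  ∈-crossEdges⁺ {(i , j) , _} t≋uy u∈X y∉X u∼y = T-does⁺ (CrossEdge? i j) (_ , _ , t≋uy , u∈X , y∉X , u∼y)

  x₁x₃-vs-crossEdges : ∀ t t' → t ∈T pair x₁ x₃ → t' ∈T crossEdges → ¬ TokAdj G t t'
  x₁x₃-vs-crossEdges t t' t∈ t'∈ adj with ∈-crossEdges⁻ t' t'∈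
  ... | u , y , t'≋uy , _ , y∉X , u∼y with TokAdj-elim {t} {t'} t'≋uy adj
  ... | inj₁ (w , t≋uw , y∼w) with IsPair-unique {t = t} (∈-pair⁻ t t∈) t≋uw
  ...   | inj₁ (refl , refl) = no-common-neighbour y∉X u∼y y∼w
  ...   | inj₂ (refl , refl) = no-common-neighbour y∉X (∼-sym y∼w) (∼-sym u∼y)
  x₁x₃-vs-crossEdges t t' t∈ t'∈ adj | u , y , t'≋uy , _ , y∉X , u∼y | inj₂ (w , t≋yw , u∼w)
    with IsPair-unique {t = t} (∈-pair⁻ t t∈) t≋yw
  ...   | inj₁ (refl , _) = y∉X (inj₁ refl)
  ...   | inj₂ (_ , refl) = y∉X (inj₂ (inj₂ refl))

  crossEdges-independent : Independent G crossEdges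
  crossEdges-independent t t' t∈ t'∈ adj with ∈-crossEdges⁻ t t∈ | ∈-crossEdges⁻ t' t'∈
  ... | u , y , t≋uy , u∈X , y∉X , u∼y | u' , y' , t'≋u'y' , u'∈X , y'∉X , u'∼y'
    with TokAdj-elim {t} {t'} t'≋u'y' adj
  ... | inj₁ (w , t≋u'w , y'∼w) with IsPair-unique {t = t} t≋uy t≋u'w
  ...   | inj₁ (refl , refl) = no-triangle u∈X u∼y (∼-sym y'∼w) (∼-sym u'∼y')
  ...   | inj₂ (_ , refl)    = y∉X u'∈X
  crossEdges-independent t t' t∈ t'∈ adj
    | u , y , t≋uy , u∈X , y∉X , u∼y | u' , y' , t'≋u'y' , u'∈X , y'∉X , u'∼y' | inj₂ (w , t≋y'w , u'∼w)
    with IsPair-unique {t = t} t≋uy t≋y'w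
  ...   | inj₁ (refl , _)    = y'∉X u∈X
  ...   | inj₂ (refl , refl) = no-triangle u∈X (∼-sym u'∼w) u'∼y' (∼-sym u∼y)

  S₀ : TokSet n
  S₀ = pair x₁ x₃ ∪ crossEdges

  S₀-independent : Independent G S₀
  S₀-independent = ∪-independent pair-independent crossEdges-independent x₁x₃-vs-crossEdges

  M : TokSet n
  M = proj₁ (extend-to-maximal S₀-independent)

  M-maximal : MaximalIndependent G M
  M-maximal = proj₁ (proj₂ (extend-to-maximal S₀-independent))

  S₀⊆M : S₀ ⊆ M
  S₀⊆M = proj₂ (proj₂ (extend-to-maximal S₀-independent))

  x₁x₃⊆M : pair x₁ x₃ ⊆ M
  x₁x₃⊆M t = S₀⊆M t ∘ ∈-∪⁺ˡ {S = pair x₁ x₃} {crossEdges} t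

  crossEdges⊆M : crossEdges ⊆ M
  crossEdges⊆M t = S₀⊆M t ∘ ∈-∪⁺ʳ {S = pair x₁ x₃} {crossEdges} t

  M-no-adjacent-pairs : ∀ {t t' w a b} → t ∈T M → t' ∈T M → IsPair t w a → IsPair t' w b → ¬ a ∼ b
  M-no-adjacent-pairs {t} {t'} t∈M t'∈M t≋wa t'≋wb a∼b =
    proj₁ M-maximal t t' t∈M t'∈M (TokAdj-intro {t} {t'} t≋wa t'≋wb a∼b)

  -- {v , w} is a cross edge, hence in M, and it would be adjacent to t.
  cross-edge-blocks : ∀ {t u v w} → t ∈T M → IsPair t w u → IsX v → ¬ IsX w → v ∼ w → ¬ u ∼ v
  cross-edge-blocks {t} t∈M t≋wu v∈X w∉X v∼w with token (∼⇒≢ (∼-sym v∼w))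
  ... | c , c≋wv = M-no-adjacent-pairs {t} {c} t∈M c∈M t≋wu c≋wv
    where
    c∈M : c ∈T M
    c∈M = crossEdges⊆M c (∈-crossEdges⁺ {c} (IsPair-swap {t = c} c≋wv) v∈X w∉X v∼w)

  classify : ∀ {e f w} → (IsX w → w ≡ e ⊎ w ≡ x₂ ⊎ w ≡ f) → w ≡ e ⊎ w ≡ x₂ ⊎ w ≡ f ⊎ ¬ IsX w
  classify {w = w} X⊆efx₂ with IsX? w
  ... | yes w∈X = map₂ (map₂ inj₁) (X⊆efx₂ w∈X)
  ... | no  w∉X = inj₂ (inj₂ (inj₂ w∉X))

  -- {e , f} = {x₁ , x₃}, so that one lemma handles both tokens x₁x₂ and x₃x₂.
  end-pair-free : ∀ {e f t t'} → IsX e → (∀ {w} → IsX w → w ≡ e ⊎ w ≡ x₂ ⊎ w ≡ f) → e ∼ x₂ → ¬ e ∼ f →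
    t ∈T M → ¬ IsPair t e f → IsPair t' e x₂ → ¬ TokAdj G t t'
  end-pair-free {e} {f} {t} {t'} e∈X X⊆efx₂ e∼x₂ e≁f t∈M t≭ef t'≋ex₂ adj with TokAdj-elim {t} {t'} t'≋ex₂ adj
  ... | inj₁ (w , t≋ew , x₂∼w) with classify {e} {f} {w} X⊆efx₂
  ...   | inj₁ refl               = IsPair-degenerate {t = t} t≋ew
  ...   | inj₂ (inj₁ refl)        = ∼-irrefl x₂∼w
  ...   | inj₂ (inj₂ (inj₁ refl)) = t≭ef t≋ew
  ...   | inj₂ (inj₂ (inj₂ w∉X))  = cross-edge-blocks {t} t∈M (IsPair-swap {t = t} t≋ew) (inj₂ (inj₁ refl)) w∉X x₂∼w e∼x₂
  end-pair-free {e} {f} {t} {t'} e∈X X⊆efx₂ e∼x₂ e≁f t∈M t≭ef t'≋ex₂ adj | inj₂ (w , t≋x₂w , e∼w)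
    with classify {e} {f} {w} X⊆efx₂
  ...   | inj₁ refl               = ∼-irrefl e∼w
  ...   | inj₂ (inj₁ refl)        = IsPair-degenerate {t = t} t≋x₂w
  ...   | inj₂ (inj₂ (inj₁ refl)) = e≁f e∼w
  ...   | inj₂ (inj₂ (inj₂ w∉X))  = cross-edge-blocks {t} t∈M (IsPair-swap {t = t} t≋x₂w) e∈X w∉X e∼w (∼-sym e∼x₂)

  N : TokSet n
  N = M ∖ pair x₁ x₃

  pathEdges : TokSet n
  pathEdges = pair x₁ x₂ ∪ pair x₂ x₃

  M′ : TokSet n
  M′ = N ∪ pathEdges

  N⊆M : N ⊆ M
  N⊆M t = proj₁ ∘ ∈-∖⁻ {S = M} {pair x₁ x₃} t

  x₁x₃-token : ∃ λ b → IsPair b x₁ x₃ × b ∈T M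
  x₁x₃-token with token x₁≢x₃
  ... | b , b≋x₁x₃ = b , b≋x₁x₃ , x₁x₃⊆M b (∈-pair⁺ b b≋x₁x₃)

  N-pathEdges-disjoint : Disjoint N pathEdges
  N-pathEdges-disjoint t t∈N t∈path with x₁x₃-token | ∈-∪⁻ {S = pair x₁ x₂} {pair x₂ x₃} t t∈path
  ... | b , b≋x₁x₃ , b∈M | inj₁ t∈x₁x₂ =
    M-no-adjacent-pairs {t} {b} (N⊆M t t∈N) b∈M (∈-pair⁻ t t∈x₁x₂) b≋x₁x₃ x₂∼x₃
  ... | b , b≋x₁x₃ , b∈M | inj₂ t∈x₂x₃ =
    M-no-adjacent-pairs {t} {b} (N⊆M t t∈N) b∈M
      (IsPair-swap {t = t} (∈-pair⁻ t t∈x₂x₃)) (IsPair-swap {t = b} b≋x₁x₃) (∼-sym x₁∼x₂)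

  x₁x₂-x₂x₃-disjoint : Disjoint (pair x₁ x₂) (pair x₂ x₃)
  x₁x₂-x₂x₃-disjoint t t∈x₁x₂ t∈x₂x₃ with IsPair-unique {t = t} (∈-pair⁻ t t∈x₁x₂) (∈-pair⁻ t t∈x₂x₃)
  ... | inj₁ (x₁≡x₂ , _) = ∼⇒≢ x₁∼x₂ x₁≡x₂
  ... | inj₂ (x₁≡x₃ , _) = x₁≢x₃ x₁≡x₃

  x₁x₂-vs-x₂x₃ : ∀ t t' → t ∈T pair x₁ x₂ → t' ∈T pair x₂ x₃ → ¬ TokAdj G t t'
  x₁x₂-vs-x₂x₃ t t' t∈ t'∈ adj with TokAdj-elim {t} {t'} (∈-pair⁻ t' t'∈) adj
  ... | inj₁ (w , t≋x₂w , x₃∼w) with IsPair-unique {t = t} (∈-pair⁻ t t∈) t≋x₂w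
  ...   | inj₁ (x₁≡x₂ , _) = ∼⇒≢ x₁∼x₂ x₁≡x₂
  ...   | inj₂ (refl , _)  = x₁≁x₃ (∼-sym x₃∼w)
  x₁x₂-vs-x₂x₃ t t' t∈ t'∈ adj | inj₂ (w , t≋x₃w , x₂∼w) with IsPair-unique {t = t} (∈-pair⁻ t t∈) t≋x₃w
  ...   | inj₁ (x₁≡x₃ , _) = x₁≢x₃ x₁≡x₃
  ...   | inj₂ (_ , x₂≡x₃) = ∼⇒≢ x₂∼x₃ x₂≡x₃

  N-vs-pathEdges : ∀ t t' → t ∈T N → t' ∈T pathEdges → ¬ TokAdj G t t'
  N-vs-pathEdges t t' t∈N t'∈path with ∈-∖⁻ {S = M} {pair x₁ x₃} t t∈N | ∈-∪⁻ {S = pair x₁ x₂} {pair x₂ x₃} t' t'∈path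
  ... | t∈M , t∉x₁x₃ | inj₁ t'∈x₁x₂ =
    end-pair-free {t = t} {t'} (inj₁ refl) id x₁∼x₂ x₁≁x₃ t∈M (t∉x₁x₃ ∘ ∈-pair⁺ t) (∈-pair⁻ t' t'∈x₁x₂)
  ... | t∈M , t∉x₁x₃ | inj₂ t'∈x₂x₃ =
    end-pair-free {t = t} {t'} (inj₂ (inj₂ refl)) reversed (∼-sym x₂∼x₃) (x₁≁x₃ ∘ ∼-sym) t∈M
      (t∉x₁x₃ ∘ ∈-pair⁺ t ∘ IsPair-swap {t = t}) (IsPair-swap {t = t'} (∈-pair⁻ t' t'∈x₂x₃))
    where
    reversed : ∀ {w} → IsX w → w ≡ x₃ ⊎ w ≡ x₂ ⊎ w ≡ x₁
    reversed (inj₁ w≡x₁)        = inj₂ (inj₂ w≡x₁)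
    reversed (inj₂ (inj₁ w≡x₂)) = inj₂ (inj₁ w≡x₂)
    reversed (inj₂ (inj₂ w≡x₃)) = inj₁ w≡x₃

  M′-independent : Independent G M′
  M′-independent =
    ∪-independent (⊆-independent N⊆M (proj₁ M-maximal))
                  (∪-independent pair-independent pair-independent x₁x₂-vs-x₂x₃)
                  N-vs-pathEdges

  card-M : card M ≡ card N + 1
  card-M = trans (card-∖ x₁x₃⊆M) (cong (card N +_) (card-pair x₁≢x₃))

  card-M′ : card M′ ≡ card N + 2
  card-M′ = begin
    card (N ∪ pathEdges)                              ≡⟨ card-∪ N-pathEdges-disjoint ⟩
    card N + card pathEdges                           ≡⟨ cong (card N +_) (card-∪ x₁x₂-x₂x₃-disjoint) ⟩
    card N + (card (pair x₁ x₂) + card (pair x₂ x₃))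
      ≡⟨ cong (card N +_) (cong₂ _+_ (card-pair (∼⇒≢ x₁∼x₂)) (card-pair (∼⇒≢ x₂∼x₃))) ⟩
    card N + 2                                        ∎

  ¬well-covered : ¬ TokenWellCovered G
  ¬well-covered well-covered with extend-to-maximal M′-independent
  ... | M″ , M″-maximal , M′⊆M″ = 2≰1 (+-cancelˡ-≤ (card N) 2 1 N+2≤N+1)
    where
    N+2≤N+1 : card N + 2 ≤ card N + 1
    N+2≤N+1 = subst₂ _≤_ card-M′ (trans (sym (well-covered M M″ M-maximal M″-maximal)) card-M) (card-mono M′⊆M″)
    2≰1 : ¬ 2 ≤ 1
    2≰1 (s≤s ())

module _ {n : ℕ} (G : Graph n) where

  private
    _≢?_ : (u v : Fin n) → Dec (u ≢ v)
    u ≢? v = ¬? (u ≟ v)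

    _∼?_ : (u v : Fin n) → Dec (u ∼[ G ] v)
    u ∼? v = T? (adj G u v)

  OnTriangle? : ∀ x → Dec (OnTriangle G x)
  OnTriangle? x = any? λ b → any? λ c →
    (x ≢? b) ×-dec (x ≢? c) ×-dec (b ≢? c) ×-dec (x ∼? b) ×-dec (b ∼? c) ×-dec (c ∼? x)

  OnCommon4Cycle? : ∀ x₁ x₂ x₃ → Dec (OnCommon4Cycle G x₁ x₂ x₃)
  OnCommon4Cycle? x₁ x₂ x₃ = any? λ a → any? λ b → any? λ c → any? λ d →
    ((a ≢? b) ×-dec (a ≢? c) ×-dec (a ≢? d) ×-dec (b ≢? c) ×-dec (b ≢? d) ×-dec (c ≢? d) ×-dec
     (a ∼? b) ×-dec (b ∼? c) ×-dec (c ∼? d) ×-dec (d ∼? a)) ×-dec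
    on (a , b , c , d) x₁ ×-dec on (a , b , c , d) x₂ ×-dec on (a , b , c , d) x₃
    where
    on : ∀ q x → Dec (x ∈4 q)
    on (a , b , c , d) x = (x ≟ a) ⊎-dec (x ≟ b) ⊎-dec (x ≟ c) ⊎-dec (x ≟ d)

theorem5p1 : (n : ℕ) → 3 ≤ n → (G : Graph n) → Connected G →
    TokenWellCovered G →
    (x₁ x₂ x₃ : Fin n) → InducedP3 G x₁ x₂ x₃ →
    OnCommon4Cycle G x₁ x₂ x₃ ⊎
    (OnTriangle G x₁ ⊎ OnTriangle G x₂ ⊎ OnTriangle G x₃)
theorem5p1 n _ G _ well-covered x₁ x₂ x₃ (x₁≢x₃ , x₁∼x₂ , x₂∼x₃ , x₁≁x₃)
  with OnCommon4Cycle? G x₁ x₂ x₃ ⊎-dec OnTriangle? G x₁ ⊎-dec OnTriangle? G x₂ ⊎-dec OnTriangle? G x₃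
... | yes holds = holds
... | no fails  = ⊥-elim (Obstruction.¬well-covered G x₁≢x₃ x₁∼x₂ x₂∼x₃ x₁≁x₃
                    (fails ∘ inj₁) (fails ∘ inj₂ ∘ inj₁) (fails ∘ inj₂ ∘ inj₂ ∘ inj₁) (fails ∘ inj₂ ∘ inj₂ ∘ inj₂)
                    well-covered)
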